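{- For every integer $n\ge 1$, $$P_n(t;x_1,\dots,x_n)=\sum_{i=1}^{n}x_1x_2\cdots x_{i-1}\cdot P_{n-1}(t;\,x_1,\dots,x_{i-1},\,t x_{i+1},\dots,t x_n).$$
   Context: For a permutation $\pi\in\mathcal S_m$, $N_{132}(\pi)$ is the number of index triples $a<b<c$ such that $\pi_a<\pi_c<\pi_b$ (occurrences of the pattern $132$). Define $$\mathrm{weight}(\pi)=t^{N_{132}(\pi)}\prod_{i=1}^{m}x_i^{\#\{(a,b):\,1\le a<b\le m,\ \pi_a>\pi_b=i\}}$$ and $P_m(t;x_1,\dots,x_m)=\sum_{\pi\in\mathcal S_m}\mathrm{weight}(\pi)$, a polynomial in $t,x_1,\dots,x_m$; here $\mathcal S_0$ consists of the empty permutation, so $P_0=1$. The notation $P_{n-1}(t;z_1,\dots,z_{n-1})$ means $P_{n-1}$ with $x_j$ replaced by $z_j$. -}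

module Defs where

open import Data.Bool using (Bool; true; false; if_then_else_; _∧_; not)
open import Data.Nat using (ℕ; zero; suc; _<ᵇ_; _≡ᵇ_)
open import Data.Fin using (Fin; toℕ; inject₁)
open import Data.Product using (_×_; _,_)
open import Data.List using (List; []; _∷_; [_]; map; concatMap; allFin; foldr)
open import Data.Vec using (Vec; []; _∷_; lookup)
open import Algebra.Bundles using (CommutativeSemiring)

countᵇ : ∀ {a} {A : Set a} → (A → Bool) → List A → ℕ
countᵇ p []       = 0
countᵇ p (x ∷ xs) = if p x then suc (countᵇ p xs) else countᵇ p xs

_<ᶠ_ : ∀ {m} → Fin m → Fin m → Bool
i <ᶠ j = toℕ i <ᵇ toℕ j

_≡ᶠ_ : ∀ {m} → Fin m → Fin m → Bool
i ≡ᶠ j = toℕ i ≡ᵇ toℕ j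

pairs : (m : ℕ) → List (Fin m × Fin m)
pairs m = concatMap (λ a → map (λ b → a , b) (allFin m)) (allFin m)

triples : (m : ℕ) → List (Fin m × Fin m × Fin m)
triples m = concatMap (λ a → map (λ bc → a , bc) (pairs m)) (allFin m)

words : (m k : ℕ) → List (Vec (Fin m) k)
words m zero    = [ [] ]
words m (suc k) = concatMap (λ v → map (λ a → a ∷ v) (allFin m)) (words m k)

isPerm : ∀ {m} → Vec (Fin m) m → Bool
isPerm {m} π = foldr (λ { (a , b) r → (not (a <ᶠ b) Data.Bool.∨ not (lookup π a ≡ᶠ lookup π b)) ∧ r }) true (pairs m)

-- the symmetric group S_m, listed (each permutation exactly once) in one-line notation
perms : (m : ℕ) → List (Vec (Fin m) m)
perms m = Data.List.filterᵇ isPerm (words m m)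

N132 : ∀ {m} → Vec (Fin m) m → ℕ
N132 {m} π = countᵇ (λ { (a , b , c) → (a <ᶠ b) ∧ (b <ᶠ c) ∧ (lookup π a <ᶠ lookup π c) ∧ (lookup π c <ᶠ lookup π b) }) (triples m)

inv : ∀ {m} → Vec (Fin m) m → Fin m → ℕ
inv {m} π i = countᵇ (λ { (a , b) → (a <ᶠ b) ∧ (lookup π b <ᶠ lookup π a) ∧ (lookup π b ≡ᶠ i) }) (pairs m)

-- evaluation of the polynomials in an arbitrary commutative semiring
module Poly {c ℓ} (R : CommutativeSemiring c ℓ) where
  open CommutativeSemiring R

  pow : Carrier → ℕ → Carrier
  pow x zero    = 1#
  pow x (suc n) = x * pow x n

  sumL : List Carrier → Carrier
  sumL = foldr _+_ 0#

  prodL : List Carrier → Carrier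
  prodL = foldr _*_ 1#

  -- weight(π) = t^{N132(π)} ∏_i x_i^{inv_i(π)}   (x indexed by Fin m, x i = x_{i+1})
  weight : ∀ {m} → Carrier → (Fin m → Carrier) → Vec (Fin m) m → Carrier
  weight {m} t x π = pow t (N132 π) * prodL (map (λ i → pow (x i) (inv π i)) (allFin m))

  P : (m : ℕ) → Carrier → (Fin m → Carrier) → Carrier
  P m t x = sumL (map (weight t x) (perms m))

  -- substituted variables for the i-th summand (0-based i, j):
  -- z_j = x_j for j < i, z_j = t · x_{j+1} for j ≥ i
  subst-z : ∀ {k} → Carrier → (Fin (suc k) → Carrier) → Fin (suc k) → Fin k → Carrier
  subst-z t x i j = if toℕ j <ᵇ toℕ i then x (inject₁ j) else t * x (Fin.suc j)
    where import Data.Fin as Fin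

  prefixProd : ∀ {k} → (Fin k → Carrier) → Fin k → Carrier
  prefixProd {k} x i = prodL (map (λ j → if j <ᶠ i then x j else 1#) (allFin k))

-- Every permutation of {0,…,k} is uniquely i ◃ u: its first letter i followed by a permutation u
-- of {0,…,k-1} whose letters ≥ i are shifted up by one. Prepending i creates no inversion onto i,
-- exactly one new inversion (with i itself) onto each smaller value, and one 132-occurrence
-- through i for each inversion of u onto a value ≥ i. Hence weight(i ◃ u) is x_1⋯x_{i-1} times
-- the weight of u in which the variable of every value ≥ i is multiplied by t, i.e. the weight
-- of u in the variables z of the i-th summand.
module Submission where

open import Defs
open import Algebra.Bundles using (CommutativeMonoid; CommutativeSemiring)
import Algebra.Properties.CommutativeMonoid.Sum as CommutativeMonoidSum
import Algebra.Properties.CommutativeSemiring.Exp as CommutativeSemiringExp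
import Algebra.Solver.CommutativeMonoid as CommutativeMonoidSolver
open import Data.Bool using (Bool; true; false; if_then_else_; _∧_; _∨_; not)
open import Data.Bool.Properties using (∧-zeroʳ; ∧-identityʳ; not-involutive)
open import Data.Empty using (⊥-elim)
open import Data.Fin using (Fin; zero; suc; toℕ; inject₁; punchIn; punchOut; _<_)
open import Data.Fin.Properties using (<-cmp; any?; punchInᵢ≢i; punchOut-injective; <⇒notInjective)
  renaming (_≟_ to _≟ᶠ_)
open import Data.List using (List; []; _∷_; _++_; map; concatMap; allFin; foldr; tabulate; filterᵇ)
open import Data.List.Properties using (map-tabulate)
open import Data.Nat using (ℕ; zero; suc; _+_; _*_; _<ᵇ_; _≡ᵇ_; s≤s; z<s)
open import Data.Nat.Properties
  using (+-*-semiring; +-comm; *-zeroʳ; +-identityʳ; m+n≡0⇒m≡0; m+n≡0⇒n≡0; n<1+n; 1+n≢0)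
open import Algebra.Properties.Semiring.Sum +-*-semiring
  using (sum-syntax; sum-cong-≗; sum-remove; ∑-comm; *-distribˡ-sum; sum-replicate-zero)
open import Data.Product using (_×_; _,_; ∃)
open import Data.Vec as Vec using (Vec; []; _∷_; lookup)
open import Data.Vec.Properties using (lookup-map)
open import Function using (_∘_; id)
open import Function.Definitions using (Injective)
open import Relation.Binary.Definitions using (tri<; tri≈; tri>)
open import Relation.Binary.PropositionalEquality
  using (_≡_; _≢_; refl; sym; trans; cong; cong₂; module ≡-Reasoning)
import Relation.Binary.Reasoning.Setoid as SetoidReasoning
open import Relation.Nullary using (yes; no; contradiction)

⟦_⟧ : Bool → ℕ
⟦ true  ⟧ = 1
⟦ false ⟧ = 0

module _ {a} {A : Set a} (p : A → Bool) where

  countᵇ-++ : ∀ xs ys → countᵇ p (xs ++ ys) ≡ countᵇ p xs + countᵇ p ys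
  countᵇ-++ []       ys = refl
  countᵇ-++ (x ∷ xs) ys with p x
  ... | true  = cong suc (countᵇ-++ xs ys)
  ... | false = countᵇ-++ xs ys

  countᵇ-tabulate : ∀ n (h : Fin n → A) → countᵇ p (tabulate h) ≡ ∑[ i < n ] ⟦ p (h i) ⟧
  countᵇ-tabulate zero    h = refl
  countᵇ-tabulate (suc n) h with p (h zero)
  ... | true  = cong suc (countᵇ-tabulate n (h ∘ suc))
  ... | false = countᵇ-tabulate n (h ∘ suc)

  countᵇ-concatMap-tabulate : ∀ {b} {B : Set b} n (h : Fin n → B) (g : B → List A) →
    countᵇ p (concatMap g (tabulate h)) ≡ ∑[ i < n ] countᵇ p (g (h i))
  countᵇ-concatMap-tabulate zero    h g = refl
  countᵇ-concatMap-tabulate (suc n) h g =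
    trans (countᵇ-++ (g (h zero)) _) (cong (countᵇ p (g (h zero)) +_) (countᵇ-concatMap-tabulate n (h ∘ suc) g))

countᵇ-map : ∀ {a b} {A : Set a} {B : Set b} (p : B → Bool) (f : A → B) xs →
  countᵇ p (map f xs) ≡ countᵇ (p ∘ f) xs
countᵇ-map p f []       = refl
countᵇ-map p f (x ∷ xs) with p (f x)
... | true  = cong suc (countᵇ-map p f xs)
... | false = countᵇ-map p f xs

countᵇ-pairs : ∀ m (p : Fin m × Fin m → Bool) →
  countᵇ p (pairs m) ≡ ∑[ a < m ] ∑[ b < m ] ⟦ p (a , b) ⟧
countᵇ-pairs m p = trans (countᵇ-concatMap-tabulate p m id _) (sum-cong-≗ λ a →
  trans (countᵇ-map p (a ,_) (allFin m)) (countᵇ-tabulate (p ∘ (a ,_)) m id))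

countᵇ-triples : ∀ m (p : Fin m × Fin m × Fin m → Bool) →
  countᵇ p (triples m) ≡ ∑[ a < m ] ∑[ b < m ] ∑[ c < m ] ⟦ p (a , b , c) ⟧
countᵇ-triples m p = trans (countᵇ-concatMap-tabulate p m id _) (sum-cong-≗ λ a →
  trans (countᵇ-map p (a ,_) (pairs m)) (countᵇ-pairs m (p ∘ (a ,_))))

∑-zero : ∀ n {f : Fin n → ℕ} → (∀ a → f a ≡ 0) → ∑[ a < n ] f a ≡ 0
∑-zero n f≡0 = trans (sum-cong-≗ f≡0) (sum-replicate-zero n)

∑-pick : ∀ {n} (w : Fin n) (f : Fin n → ℕ) → ∑[ c < n ] (⟦ w ≡ᶠ c ⟧ * f c) ≡ f w
∑-pick {suc n} zero f = begin
  f zero + 0 + ∑[ c < n ] 0 ≡⟨ cong (f zero + 0 +_) (∑-zero n λ _ → refl) ⟩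
  f zero + 0 + 0            ≡⟨ trans (+-identityʳ _) (+-identityʳ _) ⟩
  f zero                    ∎
  where open ≡-Reasoning
∑-pick {suc n} (suc w) f = ∑-pick w (f ∘ suc)

⟦x⟧*⟦a∧b∧e⟧≡⟦e⟧*⟦a∧x∧b⟧ : ∀ x a b e →
  ⟦ x ⟧ * ⟦ a ∧ b ∧ e ⟧ ≡ ⟦ e ⟧ * ⟦ a ∧ x ∧ b ⟧
⟦x⟧*⟦a∧b∧e⟧≡⟦e⟧*⟦a∧x∧b⟧ x     false b     e     = trans (*-zeroʳ ⟦ x ⟧) (sym (*-zeroʳ ⟦ e ⟧))
⟦x⟧*⟦a∧b∧e⟧≡⟦e⟧*⟦a∧x∧b⟧ false true  b     e     = sym (*-zeroʳ ⟦ e ⟧)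
⟦x⟧*⟦a∧b∧e⟧≡⟦e⟧*⟦a∧x∧b⟧ true  true  true  true  = refl
⟦x⟧*⟦a∧b∧e⟧≡⟦e⟧*⟦a∧x∧b⟧ true  true  true  false = refl
⟦x⟧*⟦a∧b∧e⟧≡⟦e⟧*⟦a∧x∧b⟧ true  true  false true  = refl
⟦x⟧*⟦a∧b∧e⟧≡⟦e⟧*⟦a∧x∧b⟧ true  true  false false = refl

∑≡0⇒≡0 : ∀ {n} (f : Fin n → ℕ) → ∑[ a < n ] f a ≡ 0 → ∀ j → f j ≡ 0
∑≡0⇒≡0 f ∑≡0 zero    = m+n≡0⇒m≡0 (f zero) ∑≡0
∑≡0⇒≡0 f ∑≡0 (suc j) = ∑≡0⇒≡0 (f ∘ suc) (m+n≡0⇒n≡0 (f zero) ∑≡0) j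

∑-single : ∀ {n} (j : Fin n) (f : Fin n → ℕ) → (∀ b → b ≢ j → f b ≡ 0) → ∑[ b < n ] f b ≡ f j
∑-single {suc n} j f vanishes = begin
  ∑[ b < suc n ] f b                  ≡⟨ sum-remove {i = j} f ⟩
  f j + ∑[ b < n ] f (punchIn j b)   ≡⟨ cong (f j +_) (∑-zero n λ b → vanishes _ (punchInᵢ≢i j b)) ⟩
  f j + 0                             ≡⟨ +-identityʳ (f j) ⟩
  f j                                 ∎
  where open ≡-Reasoning

occurs132 : ∀ {m} → Vec (Fin m) m → Fin m → Fin m → Fin m → Bool
occurs132 π a b c = (a <ᶠ b) ∧ (b <ᶠ c) ∧ (lookup π a <ᶠ lookup π c) ∧ (lookup π c <ᶠ lookup π b)

inversionOnto : ∀ {m} → Vec (Fin m) m → Fin m → Fin m → Fin m → Bool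
inversionOnto π j a b = (a <ᶠ b) ∧ (lookup π b <ᶠ lookup π a) ∧ (lookup π b ≡ᶠ j)

repeatAt : ∀ {m} → Vec (Fin m) m → Fin m → Fin m → Bool
repeatAt π a b = (a <ᶠ b) ∧ (lookup π a ≡ᶠ lookup π b)

N132≡∑ : ∀ {m} (π : Vec (Fin m) m) → N132 π ≡ ∑[ a < m ] ∑[ b < m ] ∑[ c < m ] ⟦ occurs132 π a b c ⟧
N132≡∑ {m} π = countᵇ-triples m _

inv≡∑ : ∀ {m} (π : Vec (Fin m) m) j → inv π j ≡ ∑[ a < m ] ∑[ b < m ] ⟦ inversionOnto π j a b ⟧
inv≡∑ {m} π j = countᵇ-pairs m _

repeats : ∀ {m} → Vec (Fin m) m → ℕ
repeats {m} π = ∑[ a < m ] ∑[ b < m ] ⟦ repeatAt π a b ⟧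

foldr-∧≡countᵇ≡ᵇ0 : ∀ {a} {A : Set a} (h q : A → Bool) → (∀ x → not (h x) ≡ q x) → ∀ xs →
  foldr (λ x r → h x ∧ r) true xs ≡ (countᵇ q xs ≡ᵇ 0)
foldr-∧≡countᵇ≡ᵇ0 h q h≡¬q []       = refl
foldr-∧≡countᵇ≡ᵇ0 h q h≡¬q (x ∷ xs) with h x | q x | h≡¬q x
... | true  | false | refl = foldr-∧≡countᵇ≡ᵇ0 h q h≡¬q xs
... | false | true  | refl = refl

isPerm≡repeats≡ᵇ0 : ∀ {m} (π : Vec (Fin m) m) → isPerm π ≡ (repeats π ≡ᵇ 0)
isPerm≡repeats≡ᵇ0 {m} π = trans
  (foldr-∧≡countᵇ≡ᵇ0 _ _ (λ { (a , b) → ¬[¬x∨¬y]≡x∧y (a <ᶠ b) _ }) (pairs m))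
  (cong (_≡ᵇ 0) (countᵇ-pairs m _))
  where
  ¬[¬x∨¬y]≡x∧y : ∀ x y → not (not x ∨ not y) ≡ (x ∧ y)
  ¬[¬x∨¬y]≡x∧y true  y = not-involutive y
  ¬[¬x∨¬y]≡x∧y false y = refl

_<ᶠ′_ : ∀ {m n} → Fin m → Fin n → Bool
a <ᶠ′ b = toℕ a <ᵇ toℕ b

<ᶠ-irrefl : ∀ {n} (i : Fin n) → (i <ᶠ i) ≡ false
<ᶠ-irrefl zero    = refl
<ᶠ-irrefl (suc i) = <ᶠ-irrefl i

<⇒<ᶠ : ∀ {n} {i j : Fin n} → i < j → (i <ᶠ j) ≡ true
<⇒<ᶠ {i = zero}  {suc j} _         = refl
<⇒<ᶠ {i = suc i} {suc j} (s≤s i<j) = <⇒<ᶠ i<j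

≡ᶠ-refl : ∀ {n} (i : Fin n) → (i ≡ᶠ i) ≡ true
≡ᶠ-refl zero    = refl
≡ᶠ-refl (suc i) = ≡ᶠ-refl i

≡ᶠ⇒≡ : ∀ {n} (i j : Fin n) → (i ≡ᶠ j) ≡ true → i ≡ j
≡ᶠ⇒≡ zero    zero    _ = refl
≡ᶠ⇒≡ (suc i) (suc j) e = cong suc (≡ᶠ⇒≡ i j e)

punchIn-<ᶠ : ∀ {n} (i : Fin (suc n)) a b → (punchIn i a <ᶠ punchIn i b) ≡ (a <ᶠ b)
punchIn-<ᶠ zero    a       b       = refl
punchIn-<ᶠ (suc i) zero    zero    = refl
punchIn-<ᶠ (suc i) zero    (suc b) = refl
punchIn-<ᶠ (suc i) (suc a) zero    = refl
punchIn-<ᶠ (suc i) (suc a) (suc b) = punchIn-<ᶠ i a b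

punchIn-≡ᶠ : ∀ {n} (i : Fin (suc n)) a b → (punchIn i a ≡ᶠ punchIn i b) ≡ (a ≡ᶠ b)
punchIn-≡ᶠ zero    a       b       = refl
punchIn-≡ᶠ (suc i) zero    zero    = refl
punchIn-≡ᶠ (suc i) zero    (suc b) = refl
punchIn-≡ᶠ (suc i) (suc a) zero    = refl
punchIn-≡ᶠ (suc i) (suc a) (suc b) = punchIn-≡ᶠ i a b

punchIn-≡ᶠ-pivot : ∀ {n} (i : Fin (suc n)) a → (punchIn i a ≡ᶠ i) ≡ false
punchIn-≡ᶠ-pivot zero    a       = refl
punchIn-≡ᶠ-pivot (suc i) zero    = refl
punchIn-≡ᶠ-pivot (suc i) (suc a) = punchIn-≡ᶠ-pivot i a

pivot-≡ᶠ-punchIn : ∀ {n} (i : Fin (suc n)) a → (i ≡ᶠ punchIn i a) ≡ false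
pivot-≡ᶠ-punchIn zero    a       = refl
pivot-≡ᶠ-punchIn (suc i) zero    = refl
pivot-≡ᶠ-punchIn (suc i) (suc a) = pivot-≡ᶠ-punchIn i a

punchIn-<ᶠ-pivot : ∀ {n} (i : Fin (suc n)) a → (punchIn i a <ᶠ i) ≡ (a <ᶠ′ i)
punchIn-<ᶠ-pivot zero    a       = refl
punchIn-<ᶠ-pivot (suc i) zero    = refl
punchIn-<ᶠ-pivot (suc i) (suc a) = punchIn-<ᶠ-pivot i a

pivot-<ᶠ-punchIn : ∀ {n} (i : Fin (suc n)) a → (i <ᶠ punchIn i a) ≡ not (a <ᶠ′ i)
pivot-<ᶠ-punchIn zero    a       = refl
pivot-<ᶠ-punchIn (suc i) zero    = refl
pivot-<ᶠ-punchIn (suc i) (suc a) = pivot-<ᶠ-punchIn i a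

punchIn-below : ∀ {n} (i : Fin (suc n)) a → (a <ᶠ′ i) ≡ true → punchIn i a ≡ inject₁ a
punchIn-below (suc i) zero    _ = refl
punchIn-below (suc i) (suc a) e = cong suc (punchIn-below i a e)

punchIn-above : ∀ {n} (i : Fin (suc n)) a → (a <ᶠ′ i) ≡ false → punchIn i a ≡ suc a
punchIn-above zero    a       _ = refl
punchIn-above (suc i) (suc a) e = cong suc (punchIn-above i a e)

injective⇒surjective : ∀ {n} {f : Fin n → Fin n} → Injective _≡_ _≡_ f → ∀ c → ∃ λ b → f b ≡ c
injective⇒surjective {suc n} {f} f-injective c with any? (λ b → f b ≟ᶠ c)
... | yes found = found
... | no  missed = ⊥-elim (<⇒notInjective (n<1+n n) punchOut∘f-injective)
  where
  c≢f : ∀ b → c ≢ f b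
  c≢f b c≡fb = missed (b , sym c≡fb)
  punchOut∘f-injective : Injective _≡_ _≡_ (λ b → punchOut (c≢f b))
  punchOut∘f-injective eq = f-injective (punchOut-injective (c≢f _) (c≢f _) eq)

-- Prepending a letter

infixr 5 _◃_

_◃_ : ∀ {k} → Fin (suc k) → Vec (Fin k) k → Vec (Fin (suc k)) (suc k)
i ◃ u = i ∷ Vec.map (punchIn i) u

module Prepend {k} (i : Fin (suc k)) (u : Vec (Fin k) k) where

  private
    lookup-◃ : ∀ b → lookup (Vec.map (punchIn i) u) b ≡ punchIn i (lookup u b)
    lookup-◃ b = lookup-map b (punchIn i) u

    ⟦x∧y∧false⟧ : ∀ x y → ⟦ x ∧ y ∧ false ⟧ ≡ 0
    ⟦x∧y∧false⟧ true  y = cong ⟦_⟧ (∧-zeroʳ y)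
    ⟦x∧y∧false⟧ false y = refl

  -- The 132-occurrences of i ◃ u that start at its first letter.
  new132 : ℕ
  new132 = ∑[ b < k ] ∑[ c < k ] ⟦ (b <ᶠ c) ∧ not (lookup u c <ᶠ′ i) ∧ (lookup u c <ᶠ lookup u b) ⟧

  occurs132-◃-pivot : ∀ b c → ⟦ occurs132 (i ◃ u) zero (suc b) (suc c) ⟧
    ≡ ⟦ (b <ᶠ c) ∧ not (lookup u c <ᶠ′ i) ∧ (lookup u c <ᶠ lookup u b) ⟧
  occurs132-◃-pivot b c rewrite lookup-◃ b | lookup-◃ c
    | pivot-<ᶠ-punchIn i (lookup u c) | punchIn-<ᶠ i (lookup u c) (lookup u b) = refl

  occurs132-◃-shifted : ∀ a b c → occurs132 (i ◃ u) (suc a) (suc b) (suc c) ≡ occurs132 u a b c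
  occurs132-◃-shifted a b c rewrite lookup-◃ a | lookup-◃ b | lookup-◃ c
    | punchIn-<ᶠ i (lookup u a) (lookup u c) | punchIn-<ᶠ i (lookup u c) (lookup u b) = refl

  new132≡inversionsAbove : new132 ≡ ∑[ c < k ] (⟦ not (c <ᶠ′ i) ⟧ * inv u c)
  new132≡inversionsAbove = sym (begin
    ∑[ c < k ] (⟦ not (c <ᶠ′ i) ⟧ * inv u c)
      ≡⟨ sum-cong-≗ (λ c → trans (cong (⟦ not (c <ᶠ′ i) ⟧ *_) (inv≡∑ u c))
           (trans (*-distribˡ-sum ⟦ not (c <ᶠ′ i) ⟧ (λ a → ∑[ b < k ] ⟦ inversionOnto u c a b ⟧))
             (sum-cong-≗ λ a →
               *-distribˡ-sum ⟦ not (c <ᶠ′ i) ⟧ (λ b → ⟦ inversionOnto u c a b ⟧)))) ⟩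
    ∑[ c < k ] ∑[ a < k ] ∑[ b < k ] term c a b
      ≡⟨ trans (∑-comm (λ c a → ∑[ b < k ] term c a b)) (sum-cong-≗ λ a → ∑-comm (λ c → term c a)) ⟩
    ∑[ a < k ] ∑[ b < k ] ∑[ c < k ] term c a b
      ≡⟨ sum-cong-≗ (λ a → sum-cong-≗ λ b →
           trans (sum-cong-≗ λ c → ⟦x⟧*⟦a∧b∧e⟧≡⟦e⟧*⟦a∧x∧b⟧
                    (not (c <ᶠ′ i)) (a <ᶠ b) (lookup u b <ᶠ lookup u a) (lookup u b ≡ᶠ c))
                 (∑-pick (lookup u b) λ c → ⟦ (a <ᶠ b) ∧ not (c <ᶠ′ i) ∧ (lookup u b <ᶠ lookup u a) ⟧)) ⟩
    new132 ∎)
    where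
    open ≡-Reasoning
    term : Fin k → Fin k → Fin k → ℕ
    term c a b = ⟦ not (c <ᶠ′ i) ⟧ * ⟦ inversionOnto u c a b ⟧

  N132-◃ : N132 (i ◃ u) ≡ N132 u + ∑[ c < k ] (⟦ not (c <ᶠ′ i) ⟧ * inv u c)
  N132-◃ = begin
    N132 (i ◃ u)
      ≡⟨ N132≡∑ (i ◃ u) ⟩
    ∑[ a < suc k ] ∑[ b < suc k ] ∑[ c < suc k ] ⟦ occurs132 (i ◃ u) a b c ⟧
      ≡⟨ cong₂ _+_ startingAtPivot startingLater ⟩
    new132 + N132 u
      ≡⟨ +-comm new132 (N132 u) ⟩
    N132 u + new132
      ≡⟨ cong (N132 u +_) new132≡inversionsAbove ⟩
    N132 u + ∑[ c < k ] (⟦ not (c <ᶠ′ i) ⟧ * inv u c) ∎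
    where
    open ≡-Reasoning
    startingAtPivot : ∑[ b < suc k ] ∑[ c < suc k ] ⟦ occurs132 (i ◃ u) zero b c ⟧ ≡ new132
    startingAtPivot =
      cong₂ _+_ (∑-zero (suc k) λ _ → refl) (sum-cong-≗ λ b → sum-cong-≗ (occurs132-◃-pivot b))
    startingLater : ∑[ a < k ] ∑[ b < suc k ] ∑[ c < suc k ] ⟦ occurs132 (i ◃ u) (suc a) b c ⟧ ≡ N132 u
    startingLater = trans
      (sum-cong-≗ λ a → cong₂ _+_ (∑-zero (suc k) λ _ → refl) (sum-cong-≗ λ b →
        cong₂ _+_ (cong ⟦_⟧ (∧-zeroʳ (a <ᶠ b)))
                  (sum-cong-≗ λ c → cong ⟦_⟧ (occurs132-◃-shifted a b c))))
      (sym (N132≡∑ u))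

  inv-◃-pivot : inv (i ◃ u) i ≡ 0
  inv-◃-pivot = trans (inv≡∑ (i ◃ u) i)
    (cong₂ _+_ (∑-zero k fromPivot) (∑-zero k λ a → ∑-zero k (later a)))
    where
    fromPivot : ∀ b → ⟦ inversionOnto (i ◃ u) i zero (suc b) ⟧ ≡ 0
    fromPivot b rewrite lookup-◃ b | punchIn-≡ᶠ-pivot i (lookup u b) = cong ⟦_⟧ (∧-zeroʳ _)
    later : ∀ a b → ⟦ inversionOnto (i ◃ u) i (suc a) (suc b) ⟧ ≡ 0
    later a b rewrite lookup-◃ b | punchIn-≡ᶠ-pivot i (lookup u b) = ⟦x∧y∧false⟧ (a <ᶠ b) _

  inv-◃-punchIn : ∀ c → inv (i ◃ u) (punchIn i c)
    ≡ ∑[ b < k ] ⟦ (lookup u b <ᶠ′ i) ∧ (lookup u b ≡ᶠ c) ⟧ + inv u c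
  inv-◃-punchIn c = trans (inv≡∑ (i ◃ u) (punchIn i c))
    (cong₂ _+_ (sum-cong-≗ fromPivot) (trans (sum-cong-≗ λ a → sum-cong-≗ (later a)) (sym (inv≡∑ u c))))
    where
    fromPivot : ∀ b → ⟦ inversionOnto (i ◃ u) (punchIn i c) zero (suc b) ⟧
      ≡ ⟦ (lookup u b <ᶠ′ i) ∧ (lookup u b ≡ᶠ c) ⟧
    fromPivot b rewrite lookup-◃ b | punchIn-<ᶠ-pivot i (lookup u b) | punchIn-≡ᶠ i (lookup u b) c = refl
    later : ∀ a b → ⟦ inversionOnto (i ◃ u) (punchIn i c) (suc a) (suc b) ⟧ ≡ ⟦ inversionOnto u c a b ⟧
    later a b rewrite lookup-◃ a | lookup-◃ b
      | punchIn-<ᶠ i (lookup u b) (lookup u a) | punchIn-≡ᶠ i (lookup u b) c = refl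

  repeats-◃ : repeats (i ◃ u) ≡ repeats u
  repeats-◃ = cong₂ _+_ (∑-zero k fromPivot) (sum-cong-≗ λ a → sum-cong-≗ (later a))
    where
    fromPivot : ∀ b → ⟦ repeatAt (i ◃ u) zero (suc b) ⟧ ≡ 0
    fromPivot b rewrite lookup-◃ b | pivot-≡ᶠ-punchIn i (lookup u b) = refl
    later : ∀ a b → ⟦ repeatAt (i ◃ u) (suc a) (suc b) ⟧ ≡ ⟦ repeatAt u a b ⟧
    later a b rewrite lookup-◃ a | lookup-◃ b | punchIn-≡ᶠ i (lookup u a) (lookup u b) = refl

  isPerm-◃ : isPerm (i ◃ u) ≡ isPerm u
  isPerm-◃ = trans (isPerm≡repeats≡ᵇ0 (i ◃ u))
    (trans (cong (_≡ᵇ 0) repeats-◃) (sym (isPerm≡repeats≡ᵇ0 u)))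

isPerm⇒noRepeatAt : ∀ {m} (π : Vec (Fin m) m) → isPerm π ≡ true → ∀ a b → ⟦ repeatAt π a b ⟧ ≡ 0
isPerm⇒noRepeatAt π π-perm a b = ∑≡0⇒≡0 _ (∑≡0⇒≡0 _ (≡ᵇ0⇒≡0 (repeats π) repeats≡ᵇ0) a) b
  where
  repeats≡ᵇ0 : (repeats π ≡ᵇ 0) ≡ true
  repeats≡ᵇ0 = trans (sym (isPerm≡repeats≡ᵇ0 π)) π-perm
  ≡ᵇ0⇒≡0 : ∀ n → (n ≡ᵇ 0) ≡ true → n ≡ 0
  ≡ᵇ0⇒≡0 zero _ = refl

repeatAt-≡ : ∀ {m} (π : Vec (Fin m) m) {a b} →
  a < b → lookup π a ≡ lookup π b → ⟦ repeatAt π a b ⟧ ≡ 1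
repeatAt-≡ π {a} {b} a<b πa≡πb rewrite <⇒<ᶠ a<b | πa≡πb | ≡ᶠ-refl (lookup π b) = refl

isPerm⇒distinct : ∀ {m} (π : Vec (Fin m) m) → isPerm π ≡ true →
  ∀ {a b} → a < b → lookup π a ≢ lookup π b
isPerm⇒distinct π π-perm {a} {b} a<b πa≡πb =
  1+n≢0 (trans (sym (repeatAt-≡ π a<b πa≡πb)) (isPerm⇒noRepeatAt π π-perm a b))

isPerm-∷-member : ∀ {k} (a : Fin (suc k)) (v : Vec (Fin (suc k)) k) b →
  lookup v b ≡ a → isPerm (a ∷ v) ≡ false
isPerm-∷-member a v b vb≡a with isPerm (a ∷ v) in a∷v-perm
... | false = refl
... | true  = contradiction (sym vb≡a) (isPerm⇒distinct (a ∷ v) a∷v-perm {zero} {suc b} z<s)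

module _ {k} {u : Vec (Fin k) k} (u-perm : isPerm u ≡ true) where

  isPerm⇒lookup-injective : Injective _≡_ _≡_ (lookup u)
  isPerm⇒lookup-injective {a} {b} ua≡ub with <-cmp a b
  ... | tri< a<b _ _ = contradiction ua≡ub (isPerm⇒distinct u u-perm a<b)
  ... | tri≈ _ a≡b _ = a≡b
  ... | tri> _ _ b<a = contradiction (sym ua≡ub) (isPerm⇒distinct u u-perm b<a)

  -- Every value c occurs exactly once in u, so only its position survives.
  ∑-values-below : ∀ (i : Fin (suc k)) c →
    ∑[ b < k ] ⟦ (lookup u b <ᶠ′ i) ∧ (lookup u b ≡ᶠ c) ⟧ ≡ ⟦ c <ᶠ′ i ⟧
  ∑-values-below i c with injective⇒surjective isPerm⇒lookup-injective c
  ... | b₀ , ub₀≡c = trans (∑-single b₀ _ elsewhere) atPosition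
    where
    elsewhere : ∀ b → b ≢ b₀ → ⟦ (lookup u b <ᶠ′ i) ∧ (lookup u b ≡ᶠ c) ⟧ ≡ 0
    elsewhere b b≢b₀ with lookup u b ≡ᶠ c in ub≡ᶠc
    ... | false = cong ⟦_⟧ (∧-zeroʳ _)
    ... | true  = contradiction (isPerm⇒lookup-injective (trans (≡ᶠ⇒≡ _ _ ub≡ᶠc) (sym ub₀≡c))) b≢b₀
    atPosition : ⟦ (lookup u b₀ <ᶠ′ i) ∧ (lookup u b₀ ≡ᶠ c) ⟧ ≡ ⟦ c <ᶠ′ i ⟧
    atPosition rewrite ub₀≡c | ≡ᶠ-refl c | ∧-identityʳ (c <ᶠ′ i) = refl

  inv-◃-punchIn-isPerm : ∀ i c → inv (i ◃ u) (punchIn i c) ≡ ⟦ c <ᶠ′ i ⟧ + inv u c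
  inv-◃-punchIn-isPerm i c = trans (Prepend.inv-◃-punchIn i u c) (cong (_+ inv u c) (∑-values-below i c))

-- Sums over lists in a commutative monoid

module ListSum {c ℓ} (M : CommutativeMonoid c ℓ) where

  open CommutativeMonoid M
    using (Carrier; _≈_; _∙_; ε; ∙-cong; ∙-congˡ; ∙-congʳ; assoc; identityˡ; setoid)
    renaming (refl to ≈-refl; sym to ≈-sym; trans to ≈-trans; reflexive to ≈-reflexive)
  open SetoidReasoning setoid
  module ∑ᴹ = CommutativeMonoidSum M
  open ∑ᴹ public using (sum)

  sumOver : ∀ {a} {A : Set a} → (A → Carrier) → List A → Carrier
  sumOver f xs = foldr _∙_ ε (map f xs)

  module _ {a} {A : Set a} where

    sumOver-cong : ∀ {f g : A → Carrier} → (∀ x → f x ≈ g x) → ∀ xs → sumOver f xs ≈ sumOver g xs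
    sumOver-cong f≈g []       = ≈-refl
    sumOver-cong f≈g (x ∷ xs) = ∙-cong (f≈g x) (sumOver-cong f≈g xs)

    sumOver-++ : ∀ (f : A → Carrier) xs ys → sumOver f (xs ++ ys) ≈ sumOver f xs ∙ sumOver f ys
    sumOver-++ f []       ys = ≈-sym (identityˡ _)
    sumOver-++ f (x ∷ xs) ys = ≈-trans (∙-congˡ (sumOver-++ f xs ys)) (≈-sym (assoc _ _ _))

    sumOver-filterᵇ : ∀ (f : A → Carrier) (p : A → Bool) xs →
      sumOver f (filterᵇ p xs) ≈ sumOver (λ x → if p x then f x else ε) xs
    sumOver-filterᵇ f p []       = ≈-refl
    sumOver-filterᵇ f p (x ∷ xs) with p x
    ... | true  = ∙-congˡ (sumOver-filterᵇ f p xs)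
    ... | false = ≈-trans (sumOver-filterᵇ f p xs) (≈-sym (identityˡ _))

    sumOver-∑-comm : ∀ {n} (f : A → Fin n → Carrier) xs →
      sumOver (λ x → sum (f x)) xs ≈ sum (λ j → sumOver (λ x → f x j) xs)
    sumOver-∑-comm {n} f []       = ≈-sym (∑ᴹ.sum-replicate-zero n)
    sumOver-∑-comm     f (x ∷ xs) =
      ≈-trans (∙-congˡ (sumOver-∑-comm f xs)) (≈-sym (∑ᴹ.∑-distrib-+ (f x) _))

  sumOver-map : ∀ {a b} {A : Set a} {B : Set b} (f : B → Carrier) (g : A → B) xs →
    sumOver f (map g xs) ≈ sumOver (f ∘ g) xs
  sumOver-map f g []       = ≈-refl
  sumOver-map f g (x ∷ xs) = ∙-congˡ (sumOver-map f g xs)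

  sumOver-concatMap : ∀ {a b} {A : Set a} {B : Set b} (f : B → Carrier) (g : A → List B) xs →
    sumOver f (concatMap g xs) ≈ sumOver (λ x → sumOver f (g x)) xs
  sumOver-concatMap f g []       = ≈-refl
  sumOver-concatMap f g (x ∷ xs) = ≈-trans (sumOver-++ f (g x) (concatMap g xs)) (∙-congˡ (sumOver-concatMap f g xs))

  sumOver-allFin : ∀ n (f : Fin n → Carrier) → sumOver f (allFin n) ≡ sum f
  sumOver-allFin zero    f = refl
  sumOver-allFin (suc n) f = cong (f zero ∙_) (trans
    (cong (foldr _∙_ ε) (trans (map-tabulate suc f) (sym (map-tabulate id (f ∘ suc)))))
    (sumOver-allFin n (f ∘ suc)))

  ∑-ε : ∀ {n} {f : Fin n → Carrier} → (∀ j → f j ≈ ε) → sum f ≈ ε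
  ∑-ε {n} f≈ε = ≈-trans (∑ᴹ.sum-cong-≋ f≈ε) (∑ᴹ.sum-replicate-zero n)

  sumOver-words-suc : ∀ {m n} (g : Vec (Fin m) (suc n) → Carrier) →
    sumOver g (words m (suc n)) ≈ sumOver (λ v → sum (λ a → g (a ∷ v))) (words m n)
  sumOver-words-suc {m} {n} g = begin
    sumOver g (words m (suc n))
      ≈⟨ sumOver-concatMap g _ (words m n) ⟩
    sumOver (λ v → sumOver g (map (_∷ v) (allFin m))) (words m n)
      ≈⟨ sumOver-cong (λ v → ≈-trans (sumOver-map g (_∷ v) (allFin m))
                                     (≈-reflexive (sumOver-allFin m _))) (words m n) ⟩
    sumOver (λ v → sum (λ a → g (a ∷ v))) (words m n) ∎

  sumOver-words-avoiding : ∀ {k} (a : Fin (suc k)) n (g : Vec (Fin (suc k)) n → Carrier) →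
    (∀ v b → lookup v b ≡ a → g v ≈ ε) →
    sumOver g (words (suc k) n) ≈ sumOver (g ∘ Vec.map (punchIn a)) (words k n)
  sumOver-words-avoiding a zero    g vanishes = ≈-refl
  sumOver-words-avoiding {k} a (suc n) g vanishes = begin
    sumOver g (words (suc k) (suc n))
      ≈⟨ sumOver-words-suc g ⟩
    sumOver (λ v → sum (λ b → g (b ∷ v))) (words (suc k) n)
      ≈⟨ sumOver-words-avoiding a n _ (λ v b vb≡a → ∑-ε λ b′ → vanishes (b′ ∷ v) (suc b) vb≡a) ⟩
    sumOver (λ u → sum (λ b → g (b ∷ Vec.map (punchIn a) u))) (words k n)
      ≈⟨ sumOver-cong (λ u → ≈-trans (∑ᴹ.sum-remove {i = a} (λ b → g (b ∷ Vec.map (punchIn a) u)))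
           (≈-trans (∙-congʳ (vanishes (a ∷ Vec.map (punchIn a) u) zero refl)) (identityˡ _))) (words k n) ⟩
    sumOver (λ u → sum (λ c → g (Vec.map (punchIn a) (c ∷ u)))) (words k n)
      ≈⟨ sumOver-words-suc (g ∘ Vec.map (punchIn a)) ⟨
    sumOver (g ∘ Vec.map (punchIn a)) (words k (suc n)) ∎

module Expansion {c ℓ} (R : CommutativeSemiring c ℓ) where

  open CommutativeSemiring R
    using (Carrier; _≈_; 0#; 1#; setoid; +-commutativeMonoid; *-commutativeMonoid;
           *-cong; *-congˡ; *-comm; *-identityˡ; *-identityʳ; zeroʳ; distribˡ; +-congˡ)
    renaming (_*_ to _·_; refl to ≈-refl; sym to ≈-sym; trans to ≈-trans; reflexive to ≈-reflexive)
  open CommutativeSemiringExp R using (_^_; ^-homo-*; ^-distrib-*)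
  open CommutativeMonoidSolver *-commutativeMonoid using (solve; _⊕_; _⊜_)
  open Poly R
  open SetoidReasoning setoid

  module Σ = ListSum +-commutativeMonoid
  module Π = ListSum *-commutativeMonoid
  open Σ using (sumOver)
  open Π.∑ᴹ using () renaming (sum to ∏)

  pow≡^ : ∀ x n → pow x n ≡ x ^ n
  pow≡^ x zero    = refl
  pow≡^ x (suc n) = cong (x ·_) (pow≡^ x n)

  ^-⟦⟧ : ∀ x b → x ^ ⟦ b ⟧ ≈ (if b then x else 1#)
  ^-⟦⟧ x true  = *-identityʳ x
  ^-⟦⟧ x false = ≈-refl

  ∏-^ : ∀ {n} x (e : Fin n → ℕ) → ∏ (λ j → x ^ e j) ≈ x ^ (∑[ j < n ] e j)
  ∏-^ {zero}  x e = ≈-refl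
  ∏-^ {suc n} x e = ≈-trans (*-congˡ (∏-^ x (e ∘ suc))) (≈-sym (^-homo-* x (e zero) _))

  *-distribˡ-sumOver : ∀ {a} {A : Set a} y (f : A → Carrier) xs →
    y · sumOver f xs ≈ sumOver (λ z → y · f z) xs
  *-distribˡ-sumOver y f []       = zeroʳ y
  *-distribˡ-sumOver y f (z ∷ xs) = ≈-trans (distribˡ y (f z) _) (+-congˡ (*-distribˡ-sumOver y f xs))

  weight≈ : ∀ {m} t (x : Fin m → Carrier) π → weight t x π ≈ t ^ N132 π · ∏ (λ j → x j ^ inv π j)
  weight≈ t x π = ≈-reflexive (cong₂ _·_ (pow≡^ t (N132 π))
    (trans (Π.sumOver-allFin _ (λ j → pow (x j) (inv π j)))
           (Π.∑ᴹ.sum-cong-≗ λ j → pow≡^ (x j) (inv π j))))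

  module _ {k} (t : Carrier) (x : Fin (suc k) → Carrier) (i : Fin (suc k)) where

    prefixProd≈ : prefixProd x i ≈ ∏ (λ c → x (punchIn i c) ^ ⟦ c <ᶠ′ i ⟧)
    prefixProd≈ = begin
      prefixProd x i
        ≡⟨ Π.sumOver-allFin _ (λ j → if j <ᶠ i then x j else 1#) ⟩
      ∏ (λ j → if j <ᶠ i then x j else 1#)
        ≈⟨ Π.∑ᴹ.sum-remove {i = i} (λ j → if j <ᶠ i then x j else 1#) ⟩
      (if i <ᶠ i then x i else 1#) · ∏ (λ c → if punchIn i c <ᶠ i then x (punchIn i c) else 1#)
        ≈⟨ *-cong (≈-reflexive (cong (λ b → if b then x i else 1#) (<ᶠ-irrefl i)))
                  (Π.∑ᴹ.sum-cong-≋ λ c → ≈-trans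
                    (≈-reflexive (cong (λ b → if b then x (punchIn i c) else 1#) (punchIn-<ᶠ-pivot i c)))
                    (≈-sym (^-⟦⟧ (x (punchIn i c)) (c <ᶠ′ i)))) ⟩
      1# · ∏ (λ c → x (punchIn i c) ^ ⟦ c <ᶠ′ i ⟧)
        ≈⟨ *-identityˡ _ ⟩
      ∏ (λ c → x (punchIn i c) ^ ⟦ c <ᶠ′ i ⟧) ∎

    subst-z-^ : ∀ c m → subst-z t x i c ^ m ≈ x (punchIn i c) ^ m · t ^ (⟦ not (c <ᶠ′ i) ⟧ * m)
    subst-z-^ c m with c <ᶠ′ i in c<i
    ... | true  rewrite punchIn-below i c c<i = ≈-sym (*-identityʳ _)
    ... | false rewrite punchIn-above i c c<i | +-identityʳ m =
      ≈-trans (^-distrib-* t (x (suc c)) m) (*-comm _ _)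

    module _ {u : Vec (Fin k) k} (u-perm : isPerm u ≡ true) where

      open Prepend i u using (N132-◃; inv-◃-pivot)

      inv-◃-product : ∏ (λ j → x j ^ inv (i ◃ u) j)
        ≈ ∏ (λ c → x (punchIn i c) ^ ⟦ c <ᶠ′ i ⟧) · ∏ (λ c → x (punchIn i c) ^ inv u c)
      inv-◃-product = begin
        ∏ (λ j → x j ^ inv (i ◃ u) j)
          ≈⟨ Π.∑ᴹ.sum-remove {i = i} (λ j → x j ^ inv (i ◃ u) j) ⟩
        x i ^ inv (i ◃ u) i · ∏ (λ c → x (punchIn i c) ^ inv (i ◃ u) (punchIn i c))
          ≈⟨ *-cong (≈-reflexive (cong (x i ^_) inv-◃-pivot)) (Π.∑ᴹ.sum-cong-≋ λ c →
               ≈-trans (≈-reflexive (cong (x (punchIn i c) ^_) (inv-◃-punchIn-isPerm u-perm i c)))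
                       (^-homo-* (x (punchIn i c)) ⟦ c <ᶠ′ i ⟧ (inv u c))) ⟩
        1# · ∏ (λ c → x (punchIn i c) ^ ⟦ c <ᶠ′ i ⟧ · x (punchIn i c) ^ inv u c)
          ≈⟨ *-identityˡ _ ⟩
        ∏ (λ c → x (punchIn i c) ^ ⟦ c <ᶠ′ i ⟧ · x (punchIn i c) ^ inv u c)
          ≈⟨ Π.∑ᴹ.∑-distrib-+ (λ c → x (punchIn i c) ^ ⟦ c <ᶠ′ i ⟧)
                              (λ c → x (punchIn i c) ^ inv u c) ⟩
        ∏ (λ c → x (punchIn i c) ^ ⟦ c <ᶠ′ i ⟧) · ∏ (λ c → x (punchIn i c) ^ inv u c) ∎

      subst-z-product : ∏ (λ c → subst-z t x i c ^ inv u c)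
        ≈ ∏ (λ c → x (punchIn i c) ^ inv u c) · t ^ (∑[ c < k ] (⟦ not (c <ᶠ′ i) ⟧ * inv u c))
      subst-z-product = begin
        ∏ (λ c → subst-z t x i c ^ inv u c)
          ≈⟨ Π.∑ᴹ.sum-cong-≋ (λ c → subst-z-^ c (inv u c)) ⟩
        ∏ (λ c → x (punchIn i c) ^ inv u c · t ^ (⟦ not (c <ᶠ′ i) ⟧ * inv u c))
          ≈⟨ Π.∑ᴹ.∑-distrib-+ (λ c → x (punchIn i c) ^ inv u c)
                              (λ c → t ^ (⟦ not (c <ᶠ′ i) ⟧ * inv u c)) ⟩
        ∏ (λ c → x (punchIn i c) ^ inv u c) · ∏ (λ c → t ^ (⟦ not (c <ᶠ′ i) ⟧ * inv u c))
          ≈⟨ *-congˡ (∏-^ t (λ c → ⟦ not (c <ᶠ′ i) ⟧ * inv u c)) ⟩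
        ∏ (λ c → x (punchIn i c) ^ inv u c) · t ^ (∑[ c < k ] (⟦ not (c <ᶠ′ i) ⟧ * inv u c)) ∎

      weight-◃ : weight t x (i ◃ u) ≈ prefixProd x i · weight t (subst-z t x i) u
      weight-◃ = begin
        weight t x (i ◃ u)
          ≈⟨ weight≈ t x (i ◃ u) ⟩
        t ^ N132 (i ◃ u) · ∏ (λ j → x j ^ inv (i ◃ u) j)
          ≈⟨ *-cong (≈-trans (≈-reflexive (cong (t ^_) N132-◃)) (^-homo-* t (N132 u) shift)) inv-◃-product ⟩
        (t ^ N132 u · t ^ shift) · (below · unshifted)
          ≈⟨ solve 4 (λ n s b w → (n ⊕ s) ⊕ (b ⊕ w) ⊜ b ⊕ (n ⊕ (w ⊕ s))) ≈-refl
               (t ^ N132 u) (t ^ shift) below unshifted ⟩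
        below · (t ^ N132 u · (unshifted · t ^ shift))
          ≈⟨ *-cong (≈-sym prefixProd≈) (*-congˡ (≈-sym subst-z-product)) ⟩
        prefixProd x i · (t ^ N132 u · ∏ (λ c → subst-z t x i c ^ inv u c))
          ≈⟨ *-congˡ (weight≈ t (subst-z t x i) u) ⟨
        prefixProd x i · weight t (subst-z t x i) u ∎
        where
        shift : ℕ
        shift = ∑[ c < k ] (⟦ not (c <ᶠ′ i) ⟧ * inv u c)
        below unshifted : Carrier
        below = ∏ (λ c → x (punchIn i c) ^ ⟦ c <ᶠ′ i ⟧)
        unshifted = ∏ (λ c → x (punchIn i c) ^ inv u c)

  -- Extended by 0 to all words, so that sums over S_m can follow the recursion defining words.
  permWeight : ∀ {m} → Carrier → (Fin m → Carrier) → Vec (Fin m) m → Carrier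
  permWeight t x w = if isPerm w then weight t x w else 0#

  P≈sumOver-words : ∀ m t (x : Fin m → Carrier) → P m t x ≈ sumOver (permWeight t x) (words m m)
  P≈sumOver-words m t x = Σ.sumOver-filterᵇ (weight t x) isPerm (words m m)

  permWeight-∷-member : ∀ {k} t (x : Fin (suc k) → Carrier) a (v : Vec (Fin (suc k)) k) b →
    lookup v b ≡ a → permWeight t x (a ∷ v) ≈ 0#
  permWeight-∷-member t x a v b vb≡a rewrite isPerm-∷-member a v b vb≡a = ≈-refl

  permWeight-◃ : ∀ {k} t (x : Fin (suc k) → Carrier) i (u : Vec (Fin k) k) →
    permWeight t x (i ◃ u) ≈ prefixProd x i · permWeight t (subst-z t x i) u
  permWeight-◃ t x i u rewrite Prepend.isPerm-◃ i u with isPerm u in u-perm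
  ... | true  = weight-◃ t x i u-perm
  ... | false = ≈-sym (zeroʳ _)

mainTheorem2 : ∀ {c ℓ} (R : CommutativeSemiring c ℓ) (k : ℕ)
                 (t : CommutativeSemiring.Carrier R)
                 (x : Fin (suc k) → CommutativeSemiring.Carrier R) →
                 CommutativeSemiring._≈_ R (Poly.P R (suc k) t x)
                   (Poly.sumL R (map (λ i → CommutativeSemiring._*_ R (Poly.prefixProd R x i)
                                              (Poly.P R k t (Poly.subst-z R t x i)))
                                     (allFin (suc k))))
mainTheorem2 R k t x = begin
  P (suc k) t x
    ≈⟨ P≈sumOver-words (suc k) t x ⟩
  sumOver (permWeight t x) (words (suc k) (suc k))
    ≈⟨ Σ.sumOver-words-suc (permWeight t x) ⟩
  sumOver (λ v → Σ.sum (λ i → permWeight t x (i ∷ v))) (words (suc k) k)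
    ≈⟨ Σ.sumOver-∑-comm (λ v i → permWeight t x (i ∷ v)) (words (suc k) k) ⟩
  Σ.sum (λ i → sumOver (λ v → permWeight t x (i ∷ v)) (words (suc k) k))
    ≈⟨ Σ.∑ᴹ.sum-cong-≋ (λ i → Σ.sumOver-words-avoiding i k _ (permWeight-∷-member t x i)) ⟩
  Σ.sum (λ i → sumOver (λ u → permWeight t x (i ◃ u)) (words k k))
    ≈⟨ Σ.∑ᴹ.sum-cong-≋ (λ i → ≈-trans (Σ.sumOver-cong (permWeight-◃ t x i) (words k k))
         (≈-sym (*-distribˡ-sumOver (prefixProd x i) _ (words k k)))) ⟩
  Σ.sum (λ i → prefixProd x i · sumOver (permWeight t (subst-z t x i)) (words k k))
    ≈⟨ Σ.∑ᴹ.sum-cong-≋ (λ i → *-congˡ {prefixProd x i} (P≈sumOver-words k t (subst-z t x i))) ⟨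
  Σ.sum (λ i → prefixProd x i · P k t (subst-z t x i))
    ≡⟨ Σ.sumOver-allFin (suc k) _ ⟨
  sumL (map (λ i → prefixProd x i · P k t (subst-z t x i)) (allFin (suc k))) ∎
  where
  open CommutativeSemiring R using (setoid; *-congˡ) renaming (_*_ to _·_; sym to ≈-sym; trans to ≈-trans)
  open SetoidReasoning setoid
  open Poly R
  open Expansion R
  open Σ using (sumOver)
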